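{- Let $\mathtt{FitF}$ and $\mathtt{Sim}$ be run on the same request sequence $\sigma\in[n]^T$ with cache size $k$, from arbitrary (not necessarily equal) initial cache configurations. Let $H^{1}$ be the set of rounds $t\in[T]$ with $d_{t+1}-d_t=1$, and $H^{ -1}_{1}$ the set of rounds $t\in[T]$ with $d_{t+1}-d_t=-1$ and $\delta_t=1$. Then $|H^{1}|\le 2\eta+k$ and $|H^{ -1}_{1}|\le 2\eta+2k$.
   Context: Paging with $n$ pages and cache of exactly $k<n$ pages; at round $t$, on a cache miss ($\sigma_t$ not in cache) the algorithm evicts one cached page and inserts $\sigma_t$, otherwise the cache is unchanged. $C_t$ and $\hat C_t$ are the cache configurations of $\mathtt{FitF}$ and $\mathtt{Sim}$ at round $t$; $d_t=k-|C_t\cap\hat C_t|$ and $\delta_t=\mathbf{1}[\sigma_t\notin\hat C_t]-\mathbf{1}[\sigma_t\notin C_t]$. With virtual requests $\sigma_{T+i}=i$, $A_t(i)=\min\{t'>t:\sigma_{t'}=i\}$. $\mathtt{FitF}$ evicts the cached page maximizing $A_t(i)$. $\mathtt{Sim}$, given NAT predictions $p_t\in(t,T+n]$, evicts the cached page maximizing the remedy prediction $\hat p_t(i)$ (ties arbitrary), where for an integer $Z>T+n$: $\hat p_1(i)=p_1$ if $i=\sigma_1$, else $Z+1$; for $t\ge2$, $\hat p_t(i)=p_t$ if $i=\sigma_t$; $\hat p_t(i)=Z$ if $\hat p_{t-1}(i)\le t$, $i\ne\sigma_t$ and $\hat p_{t-1}(i)\le\hat p_{t-1}(\sigma_t)<Z$;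 else $\hat p_t(i)=\hat p_{t-1}(i)$. Prediction error: a pair of rounds $\{t,t'\}$ is inverted if $A_t(\sigma_t)<A_{t'}(\sigma_{t'})$ and $p_t\ge p_{t'}$; $\mathtt{INV}$ is the set of inverted pairs, and $\eta=|\{t\in[T]: p_t\ne A_t(\sigma_t)\text{ and }\exists t'\text{ with }\{t,t'\}\in\mathtt{INV}\}|$. -}

module Defs where

open import Data.Nat using (ℕ; zero; suc; _+_; _*_; _∸_; _≤_; _<_; _≤?_; _<?_)
open import Data.Nat.Properties using (_≟_)
open import Data.Bool using (Bool; true; false; if_then_else_; _∧_; _∨_; not)
open import Data.Maybe using (Maybe; just; nothing)
open import Data.Fin using (Fin; fromℕ<)
import Data.Fin as F
open import Data.Fin.Subset using (Subset; _∈_; _∉_; _∩_; ∣_∣; inside; outside)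
open import Data.Fin.Subset.Properties using (_∈?_)
open import Data.Vec using (_[_]≔_)
open import Data.Product using (Σ; _×_; _,_)
open import Data.Sum using (_⊎_)
open import Relation.Nullary.Decidable using (⌊_⌋; yes; no)
open import Relation.Binary.PropositionalEquality using (_≡_)

-- Rounds are natural numbers; the real rounds are 1..T.
-- A request sequence σ ∈ [n]^T is given as a function σ : ℕ → Fin n of which
-- only the values σ 1, …, σ T are ever used.  Page i ∈ [n] of the paper is
-- represented by the element (i-1) : Fin n.  Predictions p are likewise a
-- function ℕ → ℕ of which only p 1, …, p T are used.

-- Extended request sequence: σ_t for 1 ≤ t ≤ T, and the virtual requests
-- σ_{T+i} = i for i ∈ [n] (i.e. at time T+1+j the page j : Fin n is requested).
σext : {n : ℕ} (T : ℕ) → (ℕ → Fin n) → ℕ → Maybe (Fin n)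
σext {n} T σ t with t ≤? T
... | yes _ = just (σ t)
... | no _ with (t ∸ suc T) <? n
...   | yes lt = just (fromℕ< lt)
...   | no _ = nothing

hits : {n : ℕ} → Maybe (Fin n) → Fin n → Bool
hits (just j) i = ⌊ j F.≟ i ⌋
hits nothing i = false

-- first s in [lo, lo + len) with f s = true (returns lo + len if none)
firstHit : (ℕ → Bool) → (lo len : ℕ) → ℕ
firstHit f lo zero = lo
firstHit f lo (suc len) = if f lo then lo else firstHit f (suc lo) len

-- A_t(i) = min { t' > t : σ_{t'} = i }  (searched over t < t' ≤ T + n,
-- which contains the minimum for every t ≤ T thanks to the virtual requests)
A : {n : ℕ} (T : ℕ) → (ℕ → Fin n) → ℕ → Fin n → ℕ
A {n} T σ t i = firstHit (λ s → hits (σext T σ s) i) (suc t) (T + n ∸ t)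

-- Remedy predictions: phat' r i = \hat p_{r+1}(i).
phat' : {n : ℕ} → (Z : ℕ) → (ℕ → Fin n) → (ℕ → ℕ) → ℕ → Fin n → ℕ
phat' Z σ p zero i = if ⌊ i F.≟ σ 1 ⌋ then p 1 else suc Z
phat' Z σ p (suc r) i =
  if ⌊ i F.≟ σ t ⌋ then p t
  else (if ⌊ prev i ≤? t ⌋ ∧ ⌊ prev i ≤? prev (σ t) ⌋ ∧ ⌊ prev (σ t) <? Z ⌋
        then Z else prev i)
  where
  t = suc (suc r)
  prev = phat' Z σ p r

phat : {n : ℕ} → (Z : ℕ) → (ℕ → Fin n) → (ℕ → ℕ) → ℕ → Fin n → ℕ
phat Z σ p t = phat' Z σ p (t ∸ 1)

Step : {n : ℕ} → (Fin n → ℕ) → Subset n → Fin n → Subset n → Set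
Step score C s C' =
  (s ∈ C × C' ≡ C)
  ⊎ (s ∉ C × Σ _ (λ e → e ∈ C × (∀ j → j ∈ C → score j ≤ score e)
                        × C' ≡ (C [ e ]≔ outside) [ s ]≔ inside))

-- C t is the cache configuration at round t (t = 1 … T+1); the initial
-- configuration C 1 is an arbitrary set of exactly k pages.
FitFRun : {n : ℕ} (k T : ℕ) → (ℕ → Fin n) → (ℕ → Subset n) → Set
FitFRun k T σ C =
  ∣ C 1 ∣ ≡ k
  × (∀ t → 1 ≤ t → t ≤ T → Step (A T σ t) (C t) (σ t) (C (suc t)))

SimRun : {n : ℕ} (k T : ℕ) → (ℕ → Fin n) → (ℕ → ℕ) → (Z : ℕ) → (ℕ → Subset n) → Set
SimRun k T σ p Z C =
  ∣ C 1 ∣ ≡ k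
  × (∀ t → 1 ≤ t → t ≤ T → Step (phat Z σ p t) (C t) (σ t) (C (suc t)))

count : (ℕ → Bool) → ℕ → ℕ
count f zero = 0
count f (suc T) = (if f (suc T) then 1 else 0) + count f T

anyUpTo : (ℕ → Bool) → ℕ → Bool
anyUpTo f zero = false
anyUpTo f (suc T) = f (suc T) ∨ anyUpTo f T

invOrd : {n : ℕ} (T : ℕ) → (ℕ → Fin n) → (ℕ → ℕ) → ℕ → ℕ → Bool
invOrd T σ p t t' = ⌊ A T σ t (σ t) <? A T σ t' (σ t') ⌋ ∧ ⌊ p t' ≤? p t ⌋

inverted : {n : ℕ} (T : ℕ) → (ℕ → Fin n) → (ℕ → ℕ) → ℕ → ℕ → Bool
inverted T σ p t t' = invOrd T σ p t t' ∨ invOrd T σ p t' t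

η : {n : ℕ} (T : ℕ) → (ℕ → Fin n) → (ℕ → ℕ) → ℕ
η T σ p = count (λ t → not ⌊ p t ≟ A T σ t (σ t) ⌋
                       ∧ anyUpTo (λ t' → inverted T σ p t t') T) T

dist : {n : ℕ} (k : ℕ) → (C Ĉ : ℕ → Subset n) → ℕ → ℕ
dist k C Ĉ t = k ∸ ∣ C t ∩ Ĉ t ∣

H1 : {n : ℕ} (k T : ℕ) → (C Ĉ : ℕ → Subset n) → ℕ
H1 k T C Ĉ = count (λ t → ⌊ dist k C Ĉ (suc t) ≟ suc (dist k C Ĉ t) ⌋) T

-- H^{-1}_1 : rounds t ∈ [T] with d_{t+1} - d_t = -1 and δ_t = 1
-- (δ_t = 1  iff  σ_t ∉ Ĉ_t and σ_t ∈ C_t)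
Hm1₁ : {n : ℕ} (k T : ℕ) → (ℕ → Fin n) → (C Ĉ : ℕ → Subset n) → ℕ
Hm1₁ k T σ C Ĉ =
  count (λ t → ⌊ dist k C Ĉ t ≟ suc (dist k C Ĉ (suc t)) ⌋
               ∧ not ⌊ σ t ∈? Ĉ t ⌋ ∧ ⌊ σ t ∈? C t ⌋) T

-- Call a page marked at round t if it has not been requested before t,
-- or if its last request τ < t is one of the rounds counted by η.  With
--   Φ_t = Σ_x ([x ∈ C_t] + [x ∈ Ĉ_t])·[last request of x counted by η]
--           + [x ∈ C_t ∩ Ĉ_t]·[x never requested]
-- we have Φ_1 ≤ |C_1| = k, and in round t only the requested page gains weight, at most 2·[t counted by η].
-- The distance d grows only on a conflict: FitF evicts r ∈ Ĉ_t and Sim evicts r̂ ∈ C_t with r ≠ r̂,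
-- so A_t(r̂) < A_t(r) and p̂_t(r) ≤ p̂_t(r̂).  The remedy rule resets p̂(x) to Z only when the last
-- request of x is counted by η, so an unmarked page still carries the prediction p_τ of its last request τ.  If r and r̂
-- were both unmarked, their last requests would form an inversion, which forces p_τ = A_τ(σ_τ) = A_t(r)
-- and likewise for r̂, contradicting the two orders above.  Hence one of r, r̂ is marked and leaving C ∩ Ĉ
-- costs it a unit of Φ, giving |H¹| ≤ Φ_1 + 2η ≤ 2η + k.  Since d moves by at most one per round,
-- |H⁻¹₁| ≤ d_1 + |H¹| ≤ 2η + 2k.

module Submission where

open import Data.Nat using (ℕ; zero; suc; _+_; _*_; _∸_; _≤_; _<_; z≤n; s≤s; _≤?_; _<?_)
open import Data.Nat.Properties
open import Data.Nat.Solver using (module +-*-Solver)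
open +-*-Solver using (solve; _:+_; _:*_; _:=_; con)
open import Data.Bool using (Bool; true; false; if_then_else_; _∧_; _∨_; not; T)
open import Data.Bool.Base using (f≤t; b≤b) renaming (_≤_ to _≤𝔹_)
import Data.Bool.Properties as 𝔹
open import Data.Fin using (Fin; zero; suc; toℕ)
import Data.Fin as F
import Data.Fin.Properties as FP
open import Data.Fin.Subset using (Subset; _∉_; _∩_; ∣_∣; inside; outside)
open import Data.Vec using ([]; _∷_; lookup; _[_]≔_)
open import Data.Vec.Properties using (lookup∘update; lookup∘update′; []=⇒lookup; lookup⇒[]=; lookup-zipWith)
open import Data.Maybe using (Maybe; just; nothing; maybe; is-nothing)
open import Data.Maybe.Properties using (just-injective)
open import Data.Product using (Σ; _×_; _,_; proj₁; proj₂)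
open import Data.Sum using (_⊎_; inj₁; inj₂)
open import Relation.Nullary using (Dec; ¬_; yes; no; contradiction)
open import Relation.Nullary.Decidable using (⌊_⌋; dec-true; dec-false; isYes≗does; toWitness)
open import Relation.Binary.PropositionalEquality
open import Algebra.Properties.Semiring.Sum +-*-semiring
  using (sum; ∑-distrib-+; sum-cong-≗; sum-replicate-zero; *-distribˡ-sum)
open import Defs

⌊⌋-yes : ∀ {a} {A : Set a} (a? : Dec A) → A → ⌊ a? ⌋ ≡ true
⌊⌋-yes a? a = trans (isYes≗does a?) (dec-true a? a)

⌊⌋-no : ∀ {a} {A : Set a} (a? : Dec A) → ¬ A → ⌊ a? ⌋ ≡ false
⌊⌋-no a? ¬a = trans (isYes≗does a?) (dec-false a? ¬a)

⌊⌋-sound : ∀ {a} {A : Set a} (a? : Dec A) → ⌊ a? ⌋ ≡ true → A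
⌊⌋-sound a? eq = toWitness {a? = a?} (subst T (sym eq) _)

𝟙 : Bool → ℕ
𝟙 b = if b then 1 else 0

𝟙≤1 : ∀ b → 𝟙 b ≤ 1
𝟙≤1 true = ≤-refl
𝟙≤1 false = z≤n

δ : {n : ℕ} → Fin n → Fin n → ℕ
δ a x = 𝟙 ⌊ x F.≟ a ⌋

δ-refl : {n : ℕ} (a : Fin n) → δ a a ≡ 1
δ-refl a = cong 𝟙 (⌊⌋-yes (a F.≟ a) refl)

δ-≢ : {n : ℕ} {a x : Fin n} → x ≢ a → δ a x ≡ 0
δ-≢ {a = a} {x} x≢a = cong 𝟙 (⌊⌋-no (x F.≟ a) x≢a)

δ-suc : {n : ℕ} (a x : Fin n) → δ (suc a) (suc x) ≡ δ a x
δ-suc a x = cong 𝟙 (trans (isYes≗does (suc x F.≟ suc a)) (sym (isYes≗does (x F.≟ a))))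

∑-mono : {n : ℕ} {f g : Fin n → ℕ} → (∀ x → f x ≤ g x) → sum f ≤ sum g
∑-mono {zero} f≤g = z≤n
∑-mono {suc n} f≤g = +-mono-≤ (f≤g zero) (∑-mono (λ x → f≤g (suc x)))

∑-δ : {n : ℕ} (a : Fin n) → sum (δ a) ≡ 1
∑-δ {suc n} zero = cong suc (sum-replicate-zero n)
∑-δ {suc n} (suc a) = trans (sum-cong-≗ {x = λ x → δ (suc a) (suc x)} {y = δ a} (δ-suc a)) (∑-δ a)

∑-mono-+ : {n : ℕ} {f g u v : Fin n → ℕ} → (∀ x → f x + u x ≤ g x + v x)
  → sum f + sum u ≤ sum g + sum v
∑-mono-+ {f = f} {g} {u} {v} pt = subst₂ _≤_ (∑-distrib-+ f u) (∑-distrib-+ g v) (∑-mono pt)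

∑-scaled-δ : {n : ℕ} (c : ℕ) (a : Fin n) → sum (λ x → c * δ a x) ≡ c
∑-scaled-δ c a = begin
  sum (λ x → c * δ a x) ≡⟨ *-distribˡ-sum c (δ a) ⟨
  c * sum (δ a)         ≡⟨ cong (c *_) (∑-δ a) ⟩
  c * 1                 ≡⟨ *-identityʳ c ⟩
  c                     ∎
  where open ≡-Reasoning

∣p∣≡∑ : {n : ℕ} (p : Subset n) → ∣ p ∣ ≡ sum (λ x → 𝟙 (lookup p x))
∣p∣≡∑ [] = refl
∣p∣≡∑ (true ∷ p) = cong suc (∣p∣≡∑ p)
∣p∣≡∑ (false ∷ p) = ∣p∣≡∑ p

count-mono : (f g : ℕ → Bool) → (∀ t → f t ≡ true → g t ≡ true) → ∀ m → count f m ≤ count g m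
count-mono f g f⇒g zero = z≤n
count-mono f g f⇒g (suc m) with f (suc m) in eq
... | true rewrite f⇒g (suc m) eq = s≤s (count-mono f g f⇒g m)
... | false = ≤-trans (count-mono f g f⇒g m) (m≤n+m _ _)

count-telescope : (h g : ℕ → Bool) (c : ℕ) (Φ : ℕ → ℕ) (T : ℕ)
  → (∀ t → 1 ≤ t → t ≤ T → 𝟙 (h t) + Φ (suc t) ≤ Φ t + c * 𝟙 (g t))
  → count h T + Φ (suc T) ≤ Φ 1 + c * count g T
count-telescope h g c Φ zero step = m≤m+n (Φ 1) (c * 0)
count-telescope h g c Φ (suc T) step = begin
  (hₜ + count h T) + Φ (2 + T)    ≡⟨ solve 3 (λ a b d → (a :+ b) :+ d := b :+ (a :+ d)) refl hₜ (count h T) _ ⟩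
  count h T + (hₜ + Φ (2 + T))    ≤⟨ +-monoʳ-≤ (count h T) (step (suc T) (s≤s z≤n) ≤-refl) ⟩
  count h T + (Φ (suc T) + c * gₜ) ≡⟨ +-assoc (count h T) _ _ ⟨
  (count h T + Φ (suc T)) + c * gₜ ≤⟨ +-monoˡ-≤ _ (count-telescope h g c Φ T earlier) ⟩
  (Φ 1 + c * count g T) + c * gₜ   ≡⟨ solve 4 (λ a c x y → (a :+ c :* y) :+ c :* x := a :+ c :* (x :+ y))
                                             refl (Φ 1) c gₜ (count g T) ⟩
  Φ 1 + c * count g (suc T)        ∎
  where
  open ≤-Reasoning
  hₜ gₜ : ℕ
  hₜ = 𝟙 (h (suc T))
  gₜ = 𝟙 (g (suc T))
  earlier : ∀ t → 1 ≤ t → t ≤ T → 𝟙 (h t) + Φ (suc t) ≤ Φ t + c * 𝟙 (g t)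
  earlier t 1≤t t≤T = step t 1≤t (m≤n⇒m≤1+n t≤T)

anyUpTo-intro : (f : ℕ → Bool) {t : ℕ} → 1 ≤ t → ∀ m → t ≤ m → f t ≡ true → anyUpTo f m ≡ true
anyUpTo-intro f (s≤s _) zero () _
anyUpTo-intro f {t} 1≤t (suc m) t≤1+m ft with t ≟ suc m
... | yes refl rewrite ft = refl
... | no t≢1+m rewrite anyUpTo-intro f 1≤t m (≤-pred (≤∧≢⇒< t≤1+m t≢1+m)) ft = 𝔹.∨-zeroʳ (f (suc m))


firstHit-≥ : (f : ℕ → Bool) (lo len : ℕ) → lo ≤ firstHit f lo len
firstHit-≥ f lo zero = ≤-refl
firstHit-≥ f lo (suc len) with f lo
... | true = ≤-refl
... | false = ≤-trans (n≤1+n lo) (firstHit-≥ f (suc lo) len)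

firstHit-skip : (f : ℕ → Bool) (lo d len : ℕ) → (∀ s → lo ≤ s → s < lo + d → f s ≡ false)
  → firstHit f lo (d + len) ≡ firstHit f (lo + d) len
firstHit-skip f lo zero len miss rewrite +-identityʳ lo = refl
firstHit-skip f lo (suc d) len miss
  rewrite miss lo ≤-refl (m<m+n lo (s≤s z≤n)) | +-suc lo d =
  firstHit-skip f (suc lo) d len (λ s lo<s s<lo+d → miss s (<⇒≤ lo<s) s<lo+d)

firstHit-hits : (f : ℕ → Bool) (lo len s : ℕ) → lo ≤ s → s < lo + len → f s ≡ true
  → f (firstHit f lo len) ≡ true
firstHit-hits f lo zero s lo≤s s<lo+0 fs = contradiction (subst (_≤ s) (sym (+-identityʳ lo)) lo≤s) (<⇒≱ s<lo+0)
firstHit-hits f lo (suc len) s lo≤s s<lo+1+len fs with f lo in eq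
... | true = eq
... | false with lo ≟ s
...   | yes refl = contradiction (trans (sym eq) fs) λ ()
...   | no lo≢s = firstHit-hits f (suc lo) len s (≤∧≢⇒< lo≤s lo≢s) (subst (s <_) (+-suc lo len) s<lo+1+len) fs

hits⇒≡ : {n : ℕ} (m : Maybe (Fin n)) (x : Fin n) → hits m x ≡ true → m ≡ just x
hits⇒≡ (just j) x h = cong just (⌊⌋-sound (j F.≟ x) h)
hits⇒≡ nothing x ()

module NextRequest {n : ℕ} (T : ℕ) (σ : ℕ → Fin n) where

  NoRequest : Fin n → ℕ → ℕ → Set
  NoRequest x lo hi = ∀ s → lo < s → s < hi → σ s ≢ x

  NoRequest-extend : ∀ {x τ t} → NoRequest x τ t → σ t ≢ x → NoRequest x τ (suc t)
  NoRequest-extend {t = t} none σt≢x s τ<s s≤t with s ≟ t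
  ... | yes refl = σt≢x
  ... | no s≢t = none s τ<s (≤∧≢⇒< (≤-pred s≤t) s≢t)

  σext-real : ∀ {s} → s ≤ T → σext T σ s ≡ just (σ s)
  σext-real {s} s≤T with s ≤? T
  ... | yes _ = refl
  ... | no s≰T = contradiction s≤T s≰T

  σext-virtual : (x : Fin n) → σext T σ (suc T + toℕ x) ≡ just x
  σext-virtual x with suc T + toℕ x ≤? T
  ... | yes T<T = contradiction (≤-trans (s≤s (m≤m+n T (toℕ x))) T<T) (n≮n T)
  ... | no _ with (suc T + toℕ x ∸ suc T) <? n
  ...   | yes lt = cong just (FP.toℕ-injective (trans (FP.toℕ-fromℕ< lt) (m+n∸m≡n (suc T) (toℕ x))))
  ...   | no ≮n = contradiction (subst (_< n) (sym (m+n∸m≡n (suc T) (toℕ x))) (FP.toℕ<n x)) ≮n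

  requests : Fin n → ℕ → Bool
  requests x s = hits (σext T σ s) x

  A-requests : ∀ {t} x → t ≤ T → σext T σ (A T σ t x) ≡ just x
  A-requests {t} x t≤T = hits⇒≡ _ x (firstHit-hits (requests x) (suc t) (T + n ∸ t) (suc T + toℕ x)
    (s≤s (≤-trans t≤T (m≤m+n T (toℕ x))))
    (subst (suc T + toℕ x <_) (cong suc (sym (m+[n∸m]≡n (≤-trans t≤T (m≤m+n T n)))))
           (s≤s (+-monoʳ-< T (FP.toℕ<n x))))
    (subst (λ m → hits m x ≡ true) (sym (σext-virtual x)) (⌊⌋-yes (x F.≟ x) refl)))

  A-injective : ∀ {t x y} → t ≤ T → A T σ t x ≡ A T σ t y → x ≡ y
  A-injective {t} {x} {y} t≤T eq = just-injective (begin
    just x                   ≡⟨ A-requests x t≤T ⟨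
    σext T σ (A T σ t x)     ≡⟨ cong (σext T σ) eq ⟩
    σext T σ (A T σ t y)     ≡⟨ A-requests y t≤T ⟩
    just y                   ∎)
    where open ≡-Reasoning

  A-skip : ∀ {τ t x} → τ ≤ t → t ≤ T → NoRequest x τ (suc t) → A T σ τ x ≡ A T σ t x
  A-skip {τ} {t} {x} τ≤t t≤T none = begin
    next (suc τ) (T + n ∸ τ)               ≡⟨ cong (next (suc τ)) split ⟩
    next (suc τ) ((t ∸ τ) + (T + n ∸ t))   ≡⟨ firstHit-skip (requests x) (suc τ) (t ∸ τ) _ silent ⟩
    next (suc τ + (t ∸ τ)) (T + n ∸ t)     ≡⟨ cong (λ m → next m (T + n ∸ t)) end ⟩
    next (suc t) (T + n ∸ t)               ∎
    where
    open ≡-Reasoning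
    next : ℕ → ℕ → ℕ
    next = firstHit (requests x)
    end : suc τ + (t ∸ τ) ≡ suc t
    end = cong suc (m+[n∸m]≡n τ≤t)
    split : T + n ∸ τ ≡ (t ∸ τ) + (T + n ∸ t)
    split = trans (cong (_∸ τ) (sym (m+[n∸m]≡n (≤-trans t≤T (m≤m+n T n))))) (+-∸-comm (T + n ∸ t) τ≤t)
    silent : ∀ s → suc τ ≤ s → s < suc τ + (t ∸ τ) → requests x s ≡ false
    silent s τ<s s<end with s<t+1 ← subst (s <_) end s<end
      rewrite σext-real (≤-trans (≤-pred s<t+1) t≤T) = ⌊⌋-no (σ s F.≟ x) (none s τ<s s<t+1)

  A-> : ∀ {τ t x} → τ ≤ t → t ≤ T → NoRequest x τ (suc t) → t < A T σ τ x
  A-> {τ} {t} {x} τ≤t t≤T none =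
    subst (t <_) (sym (A-skip τ≤t t≤T none)) (firstHit-≥ (requests x) (suc t) (T + n ∸ t))

  A-at-request : ∀ {τ t y} → τ < t → t ≤ T → σ t ≡ y → NoRequest y τ t → A T σ τ y ≡ t
  A-at-request {τ} {suc t} {y} τ<t t<T refl none =
    trans (A-skip (≤-pred τ<t) (<⇒≤ t<T) none) (found (T + n ∸ t) (m<n⇒0<n∸m (≤-trans t<T (m≤m+n T n))))
    where
    found : ∀ len → 0 < len → firstHit (requests y) (suc t) len ≡ suc t
    found (suc len) _ rewrite σext-real t<T | ⌊⌋-yes (y F.≟ y) refl = refl

module Predictions {n : ℕ} (T : ℕ) (σ : ℕ → Fin n) (p : ℕ → ℕ) where
  open NextRequest T σ

  lastReq : ℕ → Fin n → Maybe ℕ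
  lastReq zero x = nothing
  lastReq (suc zero) x = nothing
  lastReq (suc (suc t)) x = if ⌊ x F.≟ σ (suc t) ⌋ then just (suc t) else lastReq (suc t) x

  lastReq-spec : ∀ t {x τ} → lastReq t x ≡ just τ → 1 ≤ τ × τ < t × σ τ ≡ x × NoRequest x τ t
  lastReq-spec (suc (suc t)) {x} eq with x F.≟ σ (suc t) | lastReq-spec (suc t) {x}
  lastReq-spec (suc (suc t)) refl | yes x≡σt | _ =
    s≤s z≤n , ≤-refl , sym x≡σt , λ s t<s s<t+2 → contradiction t<s (<⇒≱ s<t+2)
  ... | no x≢σt | spec with spec eq
  ...   | 1≤τ , τ<t , στ≡x , none =
    1≤τ , m<n⇒m<1+n τ<t , στ≡x , NoRequest-extend none (λ e → x≢σt (sym e))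

  lastReq-here : ∀ {t} → 1 ≤ t → lastReq (suc t) (σ t) ≡ just t
  lastReq-here {suc t} _ rewrite ⌊⌋-yes (σ (suc t) F.≟ σ (suc t)) refl = refl

  lastReq-other : ∀ {t x} → 1 ≤ t → x ≢ σ t → lastReq (suc t) x ≡ lastReq t x
  lastReq-other {suc t} {x} _ x≢σt rewrite ⌊⌋-no (x F.≟ σ (suc t)) x≢σt = refl

  inInversion : ℕ → Bool
  inInversion τ = anyUpTo (inverted T σ p τ) T

  erroneous : ℕ → Bool
  erroneous τ = not ⌊ p τ ≟ A T σ τ (σ τ) ⌋ ∧ inInversion τ

  invOrd-intro : ∀ {τ τ′} → A T σ τ (σ τ) < A T σ τ′ (σ τ′) → p τ′ ≤ p τ
    → invOrd T σ p τ τ′ ≡ true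
  invOrd-intro {τ} {τ′} A< p≤
    rewrite ⌊⌋-yes (A T σ τ (σ τ) <? A T σ τ′ (σ τ′)) A< | ⌊⌋-yes (p τ′ ≤? p τ) p≤ = refl

  invOrd⇒inInversion : ∀ {τ τ′} → 1 ≤ τ → τ ≤ T → 1 ≤ τ′ → τ′ ≤ T → invOrd T σ p τ τ′ ≡ true
    → inInversion τ ≡ true × inInversion τ′ ≡ true
  invOrd⇒inInversion {τ} {τ′} 1≤τ τ≤T 1≤τ′ τ′≤T inv =
    anyUpTo-intro (inverted T σ p τ) 1≤τ′ T τ′≤T (cong (_∨ invOrd T σ p τ′ τ) inv) ,
    anyUpTo-intro (inverted T σ p τ′) 1≤τ T τ≤T
      (trans (cong (invOrd T σ p τ′ τ ∨_) inv) (𝔹.∨-zeroʳ _))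

  erroneous-intro : ∀ {τ} → inInversion τ ≡ true → p τ ≢ A T σ τ (σ τ) → erroneous τ ≡ true
  erroneous-intro {τ} inv wrong rewrite ⌊⌋-no (p τ ≟ A T σ τ (σ τ)) wrong = inv

  exact-unless-erroneous : ∀ {τ} → inInversion τ ≡ true → erroneous τ ≡ false → p τ ≡ A T σ τ (σ τ)
  exact-unless-erroneous {τ} inv ok with p τ ≟ A T σ τ (σ τ)
  ... | yes exact = exact
  ... | no _ = contradiction (trans (sym inv) ok) λ ()

  neverRequested requestedErroneously marked : ℕ → Fin n → Bool
  neverRequested t x = is-nothing (lastReq t x)
  requestedErroneously t x = maybe erroneous false (lastReq t x)
  marked t x = requestedErroneously t x ∨ neverRequested t x

  stale-prediction-erroneous : ∀ {t x τ τ′} → t ≤ T → x ≢ σ t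
    → lastReq t x ≡ just τ → lastReq t (σ t) ≡ just τ′ → p τ ≤ t → p τ ≤ p τ′
    → erroneous τ ≡ true
  stale-prediction-erroneous {t} {x} {τ} {τ′} t≤T x≢σt eqx eqσ pτ≤t pτ≤pτ′
    with 1≤τ , τ<t , refl , none ← lastReq-spec t eqx
       | 1≤τ′ , τ′<t , στ′≡σt , noneσ ← lastReq-spec t eqσ =
    erroneous-intro (proj₂ (invOrd⇒inInversion 1≤τ′ τ′≤T 1≤τ τ≤T (invOrd-intro A< pτ≤pτ′)))
      (λ exact → <⇒≱ t<Aτ (subst (_≤ t) exact pτ≤t))
    where
    τ≤T : τ ≤ T
    τ≤T = ≤-trans (<⇒≤ τ<t) t≤T
    τ′≤T : τ′ ≤ T
    τ′≤T = ≤-trans (<⇒≤ τ′<t) t≤T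
    t<Aτ : t < A T σ τ (σ τ)
    t<Aτ = A-> (<⇒≤ τ<t) t≤T (NoRequest-extend none (λ e → x≢σt (sym e)))
    A< : A T σ τ′ (σ τ′) < A T σ τ (σ τ)
    A< = subst (_< A T σ τ (σ τ))
      (sym (trans (cong (A T σ τ′) στ′≡σt) (A-at-request τ′<t t≤T refl noneσ))) t<Aτ

  module Remedy (Z : ℕ) (T<Z : T < Z) where

    -- Z ≤ p̂ covers both the initial value Z + 1 and the reset value Z.
    Tracks : ℕ → Fin n → Set
    Tracks t x = (Z ≤ phat Z σ p t x × marked (suc t) x ≡ true)
               ⊎ Σ ℕ λ τ → lastReq (suc t) x ≡ just τ × phat Z σ p t x ≡ p τ

    remedy-tracks : ∀ t → 1 ≤ t → t ≤ T → ∀ x → Tracks t x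
    remedy-tracks (suc zero) _ _ x with x F.≟ σ 1
    ... | yes _ = inj₂ (1 , refl , refl)
    ... | no _ = inj₁ (n≤1+n Z , refl)
    remedy-tracks (suc (suc r)) _ t≤T x
      with x F.≟ σ (suc (suc r)) | remedy-tracks (suc r) (s≤s z≤n) (≤-trans (n≤1+n _) t≤T)
    ... | yes _ | _ = inj₂ (suc (suc r) , refl , refl)
    ... | no x≢σt | previous
      with phat' Z σ p r x ≤? suc (suc r)
         | phat' Z σ p r x ≤? phat' Z σ p r (σ (suc (suc r)))
         | phat' Z σ p r (σ (suc (suc r))) <? Z
    ...   | no _ | _ | _ = previous x
    ...   | yes _ | no _ | _ = previous x
    ...   | yes _ | yes _ | no _ = previous x
    ...   | yes stale | yes below | yes σt<Z = inj₁ (≤-refl , reset (previous x) (previous (σ t)))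
      where
      t : ℕ
      t = suc (suc r)
      t<Z : t < Z
      t<Z = ≤-<-trans t≤T T<Z
      reset : Tracks (suc r) x → Tracks (suc r) (σ t) → marked t x ≡ true
      reset (inj₁ (Z≤ , _)) _ = contradiction (≤-trans Z≤ stale) (<⇒≱ t<Z)
      reset _ (inj₁ (Z≤ , _)) = contradiction σt<Z (≤⇒≯ Z≤)
      reset (inj₂ (τ , eqx , phx)) (inj₂ (τ′ , eqσ , phσ)) rewrite eqx =
        trans (𝔹.∨-identityʳ _)
          (stale-prediction-erroneous t≤T x≢σt eqx eqσ (subst (_≤ t) phx stale) (subst₂ _≤_ phx phσ below))

    unmarked-request : ∀ {t x} → 1 ≤ t → t ≤ T → x ≢ σ t → marked t x ≡ false
      → Σ ℕ λ τ → 1 ≤ τ × τ ≤ T × phat Z σ p t x ≡ p τ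
                × A T σ τ (σ τ) ≡ A T σ t x × erroneous τ ≡ false
    unmarked-request {t} {x} 1≤t t≤T x≢σt unmarked
      with remedy-tracks t 1≤t t≤T x
    ... | tracks rewrite lastReq-other 1≤t x≢σt with tracks
    ...   | inj₁ (_ , m) = contradiction (trans (sym m) unmarked) λ ()
    ...   | inj₂ (τ , eq , ph) with 1≤τ , τ<t , refl , none ← lastReq-spec t eq rewrite eq =
      τ , 1≤τ , ≤-trans (<⇒≤ τ<t) t≤T , ph ,
      A-skip (<⇒≤ τ<t) t≤T (NoRequest-extend none (λ e → x≢σt (sym e))) ,
      trans (sym (𝔹.∨-identityʳ _)) unmarked

    eviction-conflict-marked : ∀ {t e ê} → 1 ≤ t → t ≤ T → e ≢ ê → e ≢ σ t → ê ≢ σ t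
      → phat Z σ p t e ≤ phat Z σ p t ê → A T σ t ê ≤ A T σ t e
      → marked t e ≡ true ⊎ marked t ê ≡ true
    eviction-conflict-marked {t} {e} {ê} 1≤t t≤T e≢ê e≢σt ê≢σt ph≤ A≤
      with marked t e in me | marked t ê in mê
    ... | true | _ = inj₁ refl
    ... | false | true = inj₂ refl
    ... | false | false
      with τ , 1≤τ , τ≤T , phe , Ae , oke ← unmarked-request 1≤t t≤T e≢σt me
         | τ̂ , 1≤τ̂ , τ̂≤T , phê , Aê , okê ← unmarked-request 1≤t t≤T ê≢σt mê =
      contradiction (begin
        A T σ t e          ≡⟨ trans (sym Ae) (sym (exact-unless-erroneous inτ oke)) ⟩
        p τ                ≤⟨ subst₂ _≤_ phe phê ph≤ ⟩
        p τ̂                ≡⟨ trans (exact-unless-erroneous inτ̂ okê) Aê ⟩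
        A T σ t ê          ∎) (<⇒≱ A<)
      where
      open ≤-Reasoning
      A< : A T σ t ê < A T σ t e
      A< = ≤∧≢⇒< A≤ (λ eq → e≢ê (sym (A-injective t≤T eq)))
      inversion : inInversion τ̂ ≡ true × inInversion τ ≡ true
      inversion = invOrd⇒inInversion 1≤τ̂ τ̂≤T 1≤τ τ≤T
        (invOrd-intro (subst₂ _<_ (sym Aê) (sym Ae) A<) (subst₂ _≤_ phe phê ph≤))
      inτ : inInversion τ ≡ true
      inτ = proj₂ inversion
      inτ̂ : inInversion τ̂ ≡ true
      inτ̂ = proj₁ inversion


-- r is the evicted page; a hit is encoded by r ≡ s.
record Update {n : ℕ} (X : Fin n → Bool) (s r : Fin n) (X′ : Fin n → Bool) : Set where
  field
    inserted : X′ s ≡ true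
    kept : ∀ x → x ≢ s → x ≢ r → X′ x ≡ X x
    evicted : r ≢ s → X′ r ≡ false
    hit-or-miss : (r ≡ s × X s ≡ true) ⊎ (r ≢ s × X s ≡ false × X r ≡ true)

  shrinks : ∀ x → x ≢ s → X′ x ≤𝔹 X x
  shrinks x x≢s with x F.≟ r
  ... | yes refl rewrite evicted x≢s = 𝔹.≤-minimum (X x)
  ... | no x≢r = 𝔹.≤-reflexive (kept x x≢s x≢r)

∉⇒lookup-false : {n : ℕ} (X : Subset n) {s : Fin n} → s ∉ X → lookup X s ≡ false
∉⇒lookup-false X {s} s∉X with lookup X s in eq
... | true = contradiction (lookup⇒[]= s X eq) s∉X
... | false = refl

step⇒update : {n : ℕ} {score : Fin n → ℕ} (X : Subset n) (s : Fin n) (X′ : Subset n) → Step score X s X′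
  → Σ (Fin n) λ r → Update (lookup X) s r (lookup X′)
                    × (r ≢ s → ∀ j → lookup X j ≡ true → score j ≤ score r)
step⇒update X s .X (inj₁ (s∈X , refl)) = s , hit , λ s≢s → contradiction refl s≢s
  where
  hit : Update (lookup X) s s (lookup X)
  hit = record
    { inserted = []=⇒lookup s∈X ; kept = λ _ _ _ → refl ; evicted = λ s≢s → contradiction refl s≢s
    ; hit-or-miss = inj₁ (refl , []=⇒lookup s∈X) }
step⇒update X s .((X [ e ]≔ outside) [ s ]≔ inside) (inj₂ (s∉X , e , e∈X , maximal , refl)) =
  e , miss , λ _ j j∈X → maximal j (lookup⇒[]= j X j∈X)
  where
  X′ : Subset _
  X′ = (X [ e ]≔ outside) [ s ]≔ inside
  e≢s : e ≢ s
  e≢s refl = s∉X e∈X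
  miss : Update (lookup X) s e (lookup X′)
  miss = record
    { inserted = lookup∘update s (X [ e ]≔ outside) inside
    ; kept = λ x x≢s x≢e →
        trans (lookup∘update′ x≢s (X [ e ]≔ outside) inside) (lookup∘update′ x≢e X outside)
    ; evicted = λ e≢s → trans (lookup∘update′ e≢s (X [ e ]≔ outside) inside) (lookup∘update e X outside)
    ; hit-or-miss = inj₂ (e≢s , ∉⇒lookup-false X s∉X , []=⇒lookup e∈X) }

shared : {n : ℕ} → (Fin n → Bool) → (Fin n → Bool) → Fin n → ℕ
shared X Y x = 𝟙 (X x ∧ Y x)

weight : Bool → Bool → Bool → Bool → ℕ
weight a b s u = 𝟙 (a ∧ s) + 𝟙 (b ∧ s) + 𝟙 (a ∧ b ∧ u)

𝟙-mono : ∀ {a a′} → a′ ≤𝔹 a → 𝟙 a′ ≤ 𝟙 a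
𝟙-mono f≤t = z≤n
𝟙-mono b≤b = ≤-refl

∧-mono : ∀ {a a′ b b′} → a′ ≤𝔹 a → b′ ≤𝔹 b → (a′ ∧ b′) ≤𝔹 (a ∧ b)
∧-mono f≤t _ = 𝔹.≤-minimum _
∧-mono {true} b≤b b′≤b = b′≤b
∧-mono {false} b≤b _ = b≤b

weight-mono : ∀ {a a′ b b′} s u → a′ ≤𝔹 a → b′ ≤𝔹 b → weight a′ b′ s u ≤ weight a b s u
weight-mono s u a′≤a b′≤b =
  +-mono-≤ (+-mono-≤ (𝟙-mono (∧-mono a′≤a 𝔹.≤-refl)) (𝟙-mono (∧-mono b′≤b 𝔹.≤-refl)))
           (𝟙-mono (∧-mono a′≤a (∧-mono b′≤b 𝔹.≤-refl)))

weight-requested : ∀ b → weight true true b false ≡ 2 * 𝟙 b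
weight-requested true = refl
weight-requested false = refl

weight-loses-shared : ∀ a′ b′ {a b} s u → (a′ ∧ b′) ≡ false → (a ∧ b) ≡ true → (s ∨ u) ≡ true
  → weight a′ b′ s u + 1 ≤ weight a b s u
weight-loses-shared true false {true} {true} true u _ _ _ = s≤s (s≤s z≤n)
weight-loses-shared false true {true} {true} true u _ _ _ = s≤s (s≤s z≤n)
weight-loses-shared false false {true} {true} true u _ _ _ = s≤s z≤n
weight-loses-shared true false {true} {true} false true _ _ _ = ≤-refl
weight-loses-shared false true {true} {true} false true _ _ _ = ≤-refl
weight-loses-shared false false {true} {true} false true _ _ _ = ≤-refl

module Round {n : ℕ} {X X′ Y Y′ : Fin n → Bool} {s r r̂ : Fin n}
  (ux : Update X s r X′) (uy : Update Y s r̂ Y′) where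
  private
    module UX = Update ux
    module UY = Update uy

  shared-at-request : shared X′ Y′ s ≡ 1
  shared-at-request rewrite UX.inserted | UY.inserted = refl

  shared-kept : ∀ x → x ≢ s → x ≢ r → x ≢ r̂ → shared X′ Y′ x ≡ shared X Y x
  shared-kept x x≢s x≢r x≢r̂ rewrite UX.kept x x≢s x≢r | UY.kept x x≢s x≢r̂ = refl

  shared-missed : r ≢ s ⊎ r̂ ≢ s → shared X Y s ≡ 0
  shared-missed (inj₁ r≢s) with UX.hit-or-miss
  ... | inj₁ (r≡s , _) = contradiction r≡s r≢s
  ... | inj₂ (_ , Xs≡false , _) rewrite Xs≡false = refl
  shared-missed (inj₂ r̂≢s) with UY.hit-or-miss
  ... | inj₁ (r̂≡s , _) = contradiction r̂≡s r̂≢s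
  ... | inj₂ (_ , Ys≡false , _) rewrite Ys≡false = cong 𝟙 (𝔹.∧-zeroʳ (X s))

  shared-drop-≤1 : sum (shared X Y) ≤ sum (shared X′ Y′) + 1
  shared-drop-≤1 = +-cancelʳ-≤ 1 _ _ (subst₂ _≤_
    (cong (sum (shared X Y) +_) (∑-δ s))
    (trans (cong (sum (shared X′ Y′) +_) (trans (∑-distrib-+ (δ r) (δ r̂)) (cong₂ _+_ (∑-δ r) (∑-δ r̂))))
           (sym (+-assoc _ 1 1)))
    (∑-mono-+ pointwise))
    where
    pointwise : ∀ x → shared X Y x + δ s x ≤ shared X′ Y′ x + (δ r x + δ r̂ x)
    pointwise x with x F.≟ s | x F.≟ r | x F.≟ r̂
    ... | yes refl | yes refl | _ rewrite shared-at-request =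
      +-mono-≤ (𝟙≤1 _) (s≤s z≤n)
    ... | yes refl | no x≢r | _ rewrite shared-at-request | shared-missed (inj₁ (≢-sym x≢r)) =
      s≤s z≤n
    ... | no _ | yes refl | _ rewrite +-identityʳ (shared X Y x) =
      ≤-trans (𝟙≤1 _) (≤-trans (s≤s z≤n) (m≤n+m _ _))
    ... | no _ | no _ | yes refl rewrite +-identityʳ (shared X Y x) =
      ≤-trans (𝟙≤1 _) (≤-trans (s≤s z≤n) (m≤n+m _ _))
    ... | no x≢s | no x≢r | no x≢r̂ rewrite shared-kept x x≢s x≢r x≢r̂ =
      ≤-refl

  Harmless : Fin n → Fin n → Set
  Harmless y z = z ≡ s ⊎ z ≡ y ⊎ shared X Y z ≡ 0

  shared-grows-unless : (y : Fin n) → shared X Y s ≡ 0 ⊎ y ≡ s → Harmless y r → Harmless y r̂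
    → sum (shared X Y) ≤ sum (shared X′ Y′)
  shared-grows-unless y at-request r-harmless r̂-harmless = +-cancelʳ-≤ 1 _ _
    (subst₂ _≤_ (cong (sum (shared X Y) +_) (∑-δ s)) (cong (sum (shared X′ Y′) +_) (∑-δ y))
                (∑-mono-+ pointwise))
    where
    vanishes : ∀ {z} → Harmless y z → z ≢ s → z ≢ y → shared X Y z ≡ 0
    vanishes (inj₁ z≡s) z≢s _ = contradiction z≡s z≢s
    vanishes (inj₂ (inj₁ z≡y)) _ z≢y = contradiction z≡y z≢y
    vanishes (inj₂ (inj₂ z≡0)) _ _ = z≡0
    request : shared X Y s ≡ 0 ⊎ y ≡ s → shared X Y s + 1 ≤ 1 + δ y s
    request (inj₁ Is≡0) rewrite Is≡0 = s≤s z≤n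
    request (inj₂ y≡s) rewrite y≡s | δ-refl s = +-monoˡ-≤ 1 (𝟙≤1 _)
    pointwise : ∀ x → shared X Y x + δ s x ≤ shared X′ Y′ x + δ y x
    pointwise x with x F.≟ s
    pointwise x | yes refl rewrite shared-at-request = request at-request
    pointwise x | no x≢s with x F.≟ y
    ... | yes refl rewrite +-identityʳ (shared X Y x) = ≤-trans (𝟙≤1 _) (m≤n+m 1 _)
    ... | no x≢y = +-monoˡ-≤ 0 away
      where
      away : shared X Y x ≤ shared X′ Y′ x
      away with x F.≟ r | x F.≟ r̂
      ... | yes refl | _ rewrite vanishes r-harmless x≢s x≢y = z≤n
      ... | no _ | yes refl rewrite vanishes r̂-harmless x≢s x≢y = z≤n
      ... | no x≢r | no x≢r̂ = ≤-reflexive (sym (shared-kept x x≢s x≢r x≢r̂))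

  Conflict : Set
  Conflict = r ≢ s × r̂ ≢ s × r ≢ r̂ × Y r ≡ true × X r̂ ≡ true

  conflict-or-shared-grows : Conflict ⊎ sum (shared X Y) ≤ sum (shared X′ Y′)
  conflict-or-shared-grows with r F.≟ s | r̂ F.≟ s
  ... | yes r≡s | yes r̂≡s = inj₂ (shared-grows-unless r̂ (inj₂ r̂≡s) (inj₁ r≡s) (inj₂ (inj₁ refl)))
  ... | yes r≡s | no r̂≢s =
    inj₂ (shared-grows-unless r̂ (inj₁ (shared-missed (inj₂ r̂≢s))) (inj₁ r≡s) (inj₂ (inj₁ refl)))
  ... | no r≢s | yes r̂≡s =
    inj₂ (shared-grows-unless r (inj₁ (shared-missed (inj₁ r≢s))) (inj₂ (inj₁ refl)) (inj₁ r̂≡s))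
  ... | no r≢s | no r̂≢s with r F.≟ r̂ | Y r in Yr | X r̂ in Xr̂
  ...   | yes r≡r̂ | _ | _ =
    inj₂ (shared-grows-unless r (inj₁ (shared-missed (inj₁ r≢s)))
           (inj₂ (inj₁ refl)) (inj₂ (inj₁ (sym r≡r̂))))
  ...   | no _ | false | _ =
    inj₂ (shared-grows-unless r̂ (inj₁ (shared-missed (inj₁ r≢s)))
           (inj₂ (inj₂ (cong 𝟙 (trans (cong (X r ∧_) Yr) (𝔹.∧-zeroʳ (X r)))))) (inj₂ (inj₁ refl)))
  ...   | no _ | true | false =
    inj₂ (shared-grows-unless r (inj₁ (shared-missed (inj₁ r≢s)))
           (inj₂ (inj₁ refl)) (inj₂ (inj₂ (cong (λ b → 𝟙 (b ∧ Y r̂)) Xr̂))))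
  ...   | no r≢r̂ | true | true = inj₁ (r≢s , r̂≢s , r≢r̂ , refl , refl)

  conflict-loses : Conflict → ((X r ∧ Y r) ≡ true × (X′ r ∧ Y′ r) ≡ false)
                             × ((X r̂ ∧ Y r̂) ≡ true × (X′ r̂ ∧ Y′ r̂) ≡ false)
  conflict-loses (r≢s , r̂≢s , _ , Yr , Xr̂) with UX.hit-or-miss | UY.hit-or-miss
  ... | inj₁ (r≡s , _) | _ = contradiction r≡s r≢s
  ... | inj₂ _ | inj₁ (r̂≡s , _) = contradiction r̂≡s r̂≢s
  ... | inj₂ (_ , _ , Xr) | inj₂ (_ , _ , Yr̂) =
    (cong₂ _∧_ Xr Yr , cong (_∧ Y′ r) (UX.evicted r≢s)) ,
    (cong₂ _∧_ Xr̂ Yr̂ , trans (cong (X′ r̂ ∧_) (UY.evicted r̂≢s)) (𝔹.∧-zeroʳ (X′ r̂)))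

  module Weight (S U S′ U′ : Fin n → Bool) (b : Bool)
    (S-kept : ∀ x → x ≢ s → S′ x ≡ S x) (U-kept : ∀ x → x ≢ s → U′ x ≡ U x)
    (S′-request : S′ s ≡ b) (U′-request : U′ s ≡ false) where

    w w′ : Fin n → ℕ
    w x = weight (X x) (Y x) (S x) (U x)
    w′ x = weight (X′ x) (Y′ x) (S′ x) (U′ x)

    weight-pointwise : ∀ x → w′ x ≤ w x + 2 * 𝟙 b * δ s x
    weight-pointwise x with x F.≟ s
    ... | yes refl rewrite UX.inserted | UY.inserted | S′-request | U′-request
                         | weight-requested b | *-identityʳ (2 * 𝟙 b) = m≤n+m (2 * 𝟙 b) (w x)
    ... | no x≢s rewrite *-zeroʳ (2 * 𝟙 b) | +-identityʳ (w x) | S-kept x x≢s | U-kept x x≢s =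
      weight-mono (S x) (U x) (UX.shrinks x x≢s) (UY.shrinks x x≢s)

    weight-rise-≤ : sum w′ ≤ sum w + 2 * 𝟙 b
    weight-rise-≤ = subst (sum w′ ≤_)
      (trans (∑-distrib-+ w (λ x → 2 * 𝟙 b * δ s x)) (cong (sum w +_) (∑-scaled-δ (2 * 𝟙 b) s)))
      (∑-mono weight-pointwise)

    weight-drops-at : ∀ e → e ≢ s → (X e ∧ Y e) ≡ true → (X′ e ∧ Y′ e) ≡ false → (S e ∨ U e) ≡ true
      → sum w′ + 1 ≤ sum w + 2 * 𝟙 b
    weight-drops-at e e≢s before after marked = subst₂ _≤_
      (cong (sum w′ +_) (∑-δ e)) (cong (sum w +_) (∑-scaled-δ (2 * 𝟙 b) s)) (∑-mono-+ pointwise)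
      where
      pointwise : ∀ x → w′ x + δ e x ≤ w x + 2 * 𝟙 b * δ s x
      pointwise x with x F.≟ e
      ... | yes refl rewrite δ-≢ e≢s | *-zeroʳ (2 * 𝟙 b) | +-identityʳ (w x)
                           | S-kept x e≢s | U-kept x e≢s =
        weight-loses-shared (X′ x) (Y′ x) {X x} {Y x} (S x) (U x) after before marked
      ... | no x≢e rewrite +-identityʳ (w′ x) = weight-pointwise x

    weight-drops-on-conflict : Conflict → (S r ∨ U r) ≡ true ⊎ (S r̂ ∨ U r̂) ≡ true
      → sum w′ + 1 ≤ sum w + 2 * 𝟙 b
    weight-drops-on-conflict conflict@(r≢s , r̂≢s , _) marks
      with (r-before , r-after) , (r̂-before , r̂-after) ← conflict-loses conflict | marks
    ... | inj₁ r-marked = weight-drops-at r r≢s r-before r-after r-marked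
    ... | inj₂ r̂-marked = weight-drops-at r̂ r̂≢s r̂-before r̂-after r̂-marked


∸-suc-bound : ∀ k {a a′} → a ≤ a′ + 1 → k ∸ a′ ≤ suc (k ∸ a)
∸-suc-bound zero {a′ = a′} _ rewrite 0∸n≡0 a′ = z≤n
∸-suc-bound (suc k) {zero} {a′} _ = ≤-trans (m∸n≤m (suc k) a′) (n≤1+n _)
∸-suc-bound (suc k) {suc zero} {zero} _ = ≤-refl
∸-suc-bound (suc k) {suc (suc a)} {zero} (s≤s ())
∸-suc-bound (suc k) {suc a} {suc a′} (s≤s a≤a′+1) = ∸-suc-bound k a≤a′+1

∸-no-rise : ∀ k {a a′} → a ≤ a′ → ⌊ k ∸ a′ ≟ suc (k ∸ a) ⌋ ≡ false
∸-no-rise k a≤a′ = ⌊⌋-no (_ ≟ _) (<⇒≢ (s≤s (∸-monoʳ-≤ k a≤a′)))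

fall-rise : ∀ a {b} → b ≤ suc a → 𝟙 ⌊ a ≟ suc b ⌋ + b ≤ a + 𝟙 ⌊ b ≟ suc a ⌋
fall-rise a {b} b≤1+a with a ≟ suc b | b ≟ suc a
... | yes refl | yes b≡2+b = contradiction (≤-reflexive (sym b≡2+b)) (<⇒≱ (m<n⇒m<1+n (n<1+n b)))
... | yes refl | no _ = m≤m+n (suc b) 0
... | no _ | yes refl = ≤-reflexive (+-comm 1 a)
... | no _ | no b≢1+a = ≤-trans (≤-pred (≤∧≢⇒< b≤1+a b≢1+a)) (m≤m+n a 0)

initial-weight : ∀ a b → weight a b false true ≤ 𝟙 a
initial-weight true true = ≤-refl
initial-weight true false = z≤n
initial-weight false true = z≤n
initial-weight false false = z≤n

∧-trueˡ : ∀ {a b} → (a ∧ b) ≡ true → a ≡ true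
∧-trueˡ {true} _ = refl

module Analysis {n k T : ℕ} {σ : ℕ → Fin n} {p : ℕ → ℕ} {Z : ℕ} (T<Z : T < Z)
  {C Ĉ : ℕ → Subset n} (fitf : FitFRun k T σ C) (sim : SimRun k T σ p Z Ĉ) where
  open Predictions T σ p
  open Remedy Z T<Z

  d : ℕ → ℕ
  d = dist k C Ĉ

  rise fall : ℕ → Bool
  rise t = ⌊ d (suc t) ≟ suc (d t) ⌋
  fall t = ⌊ d t ≟ suc (d (suc t)) ⌋

  common : ℕ → ℕ
  common t = sum (shared (lookup (C t)) (lookup (Ĉ t)))

  ∣C∩Ĉ∣≡common : ∀ t → ∣ C t ∩ Ĉ t ∣ ≡ common t
  ∣C∩Ĉ∣≡common t =
    trans (∣p∣≡∑ (C t ∩ Ĉ t)) (sum-cong-≗ (λ x → cong 𝟙 (lookup-zipWith _∧_ x (C t) (Ĉ t))))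

  Φ : ℕ → ℕ
  Φ t = sum (λ x → weight (lookup (C t) x) (lookup (Ĉ t) x) (requestedErroneously t x) (neverRequested t x))

  round : ∀ t → 1 ≤ t → t ≤ T
    → (𝟙 (rise t) + Φ (suc t) ≤ Φ t + 2 * 𝟙 (erroneous t)) × d (suc t) ≤ suc (d t)
  round t 1≤t t≤T
    with r , ux , fitf-max ← step⇒update (C t) (σ t) (C (suc t)) (proj₂ fitf t 1≤t t≤T)
       | r̂ , uy , sim-max ← step⇒update (Ĉ t) (σ t) (Ĉ (suc t)) (proj₂ sim t 1≤t t≤T) = potential , distance
    where
    open Round ux uy
    open Weight (requestedErroneously t) (neverRequested t) (requestedErroneously (suc t)) (neverRequested (suc t))
      (erroneous t)
      (λ x x≢σt → cong (maybe erroneous false) (lastReq-other 1≤t x≢σt))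
      (λ x x≢σt → cong is-nothing (lastReq-other 1≤t x≢σt))
      (cong (maybe erroneous false) (lastReq-here 1≤t))
      (cong is-nothing (lastReq-here 1≤t))
    distance : d (suc t) ≤ suc (d t)
    distance = subst₂ (λ a a′ → k ∸ a′ ≤ suc (k ∸ a))
      (sym (∣C∩Ĉ∣≡common t)) (sym (∣C∩Ĉ∣≡common (suc t))) (∸-suc-bound k shared-drop-≤1)
    potential : 𝟙 (rise t) + Φ (suc t) ≤ Φ t + 2 * 𝟙 (erroneous t)
    potential with conflict-or-shared-grows
    ... | inj₂ grows rewrite ∣C∩Ĉ∣≡common t | ∣C∩Ĉ∣≡common (suc t) | ∸-no-rise k grows =
      weight-rise-≤
    ... | inj₁ conflict@(r≢s , r̂≢s , r≢r̂ , Ĉr , Cr̂) = begin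
      𝟙 (rise t) + Φ (suc t)     ≤⟨ +-monoˡ-≤ _ (𝟙≤1 (rise t)) ⟩
      1 + Φ (suc t)              ≡⟨ +-comm 1 _ ⟩
      Φ (suc t) + 1              ≤⟨ weight-drops-on-conflict conflict marks ⟩
      Φ t + 2 * 𝟙 (erroneous t)  ∎
      where
      open ≤-Reasoning
      marks : marked t r ≡ true ⊎ marked t r̂ ≡ true
      marks = eviction-conflict-marked 1≤t t≤T r≢r̂ r≢s r̂≢s (sim-max r̂≢s r Ĉr) (fitf-max r≢s r̂ Cr̂)

  Φ₁≤k : Φ 1 ≤ k
  Φ₁≤k = begin
    Φ 1                              ≤⟨ ∑-mono (λ x → initial-weight (lookup (C 1) x) (lookup (Ĉ 1) x)) ⟩
    sum (λ x → 𝟙 (lookup (C 1) x))   ≡⟨ ∣p∣≡∑ (C 1) ⟨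
    ∣ C 1 ∣                          ≡⟨ proj₁ fitf ⟩
    k                                ∎
    where open ≤-Reasoning

  rises-bound : count rise T ≤ 2 * η T σ p + k
  rises-bound = begin
    count rise T                          ≤⟨ m≤m+n _ (Φ (suc T)) ⟩
    count rise T + Φ (suc T)              ≤⟨ count-telescope rise erroneous 2 Φ T Φ-step ⟩
    Φ 1 + 2 * count erroneous T           ≤⟨ +-monoˡ-≤ _ Φ₁≤k ⟩
    k + 2 * η T σ p                       ≡⟨ +-comm k _ ⟩
    2 * η T σ p + k                       ∎
    where
    open ≤-Reasoning
    Φ-step : ∀ t → 1 ≤ t → t ≤ T → 𝟙 (rise t) + Φ (suc t) ≤ Φ t + 2 * 𝟙 (erroneous t)
    Φ-step t 1≤t t≤T = proj₁ (round t 1≤t t≤T)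

  falls-bound : count fall T ≤ 2 * η T σ p + 2 * k
  falls-bound = begin
    count fall T               ≤⟨ m≤m+n _ (d (suc T)) ⟩
    count fall T + d (suc T)   ≤⟨ count-telescope fall rise 1 d T d-step ⟩
    d 1 + 1 * count rise T     ≤⟨ +-mono-≤ (m∸n≤m k ∣ C 1 ∩ Ĉ 1 ∣) (≤-reflexive (*-identityˡ _)) ⟩
    k + count rise T           ≤⟨ +-monoʳ-≤ k rises-bound ⟩
    k + (2 * η T σ p + k)      ≡⟨ solve 2 (λ k e → k :+ (e :+ k) := e :+ con 2 :* k) refl k (2 * η T σ p) ⟩
    2 * η T σ p + 2 * k        ∎
    where
    open ≤-Reasoning
    d-step : ∀ t → 1 ≤ t → t ≤ T → 𝟙 (fall t) + d (suc t) ≤ d t + 1 * 𝟙 (rise t)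
    d-step t 1≤t t≤T rewrite *-identityˡ (𝟙 (rise t)) = fall-rise (d t) (proj₂ (round t 1≤t t≤T))

lemma17 : (n k T : ℕ) → k < n → (σ : ℕ → Fin n) → (p : ℕ → ℕ) → (Z : ℕ)
    → T + n < Z
    → (∀ t → 1 ≤ t → t ≤ T → t < p t × p t ≤ T + n)
    → (C Ĉ : ℕ → Subset n)
    → FitFRun k T σ C → SimRun k T σ p Z Ĉ
    → H1 k T C Ĉ ≤ 2 * η T σ p + k
    × Hm1₁ k T σ C Ĉ ≤ 2 * η T σ p + 2 * k
lemma17 n k T _ σ p Z T+n<Z _ C Ĉ fitf sim =
  rises-bound , ≤-trans (count-mono _ fall (λ _ → ∧-trueˡ) T) falls-bound
  where open Analysis (≤-<-trans (m≤m+n T n) T+n<Z) fitf sim
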